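{- For every positive integer $n$ there is a bijection $\varphi_n:\mathcal{O}_n\to\mathcal{T}_n$, where $\mathcal{O}_n$ is the set of ordered $n$-configurations and $\mathcal{T}_n$ is the set of $n$-configurations without towers.
   Context: An $n$-configuration is a $2\times n$ rectangle of $2n$ slots (2 rows, $n$ columns) in which exactly $n$ of the $2n$ slots are painted, each painted slot receiving one of two colors (color one or color two), subject to the restriction that no column contains slots of both colors. Its type is the pair $(i,j)$ with $i+j=n$, where $i$ slots have color one and $j$ slots have color two. A column with two colored slots is called a tower. An $n$-configuration of type $(i,j)$ is ordered if all $i$ slots of color one lie in the leftmost $2\times i$ subrectangle (the first $i$ columns) and all $j$ slots of color two lie in the complementary $2\times j$ subrectangle (the last $j$ columns). Thus $|\mathcal{O}_n|=\sum_{i+j=n}\binom{2i}{i}\binom{2j}{j}$ and $|\mathcal{T}_n|=4^n$. -}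

module Defs where

open import Data.Bool using (Bool; true; false; _∧_; _∨_; not; T)
open import Data.Nat using (ℕ; zero; suc; _+_; _≡ᵇ_)
open import Data.Product using (Σ; _×_; _,_)
open import Data.Vec using (Vec; []; _∷_)

data Slot : Set where
  empty one two : Slot

-- A column of the 2 × n rectangle: (top slot , bottom slot).
Column : Set
Column = Slot × Slot

-- A 2 × n rectangle with painted slots, read column by column, left to right.
Grid : ℕ → Set
Grid n = Vec Column n

isPainted : Slot → ℕ
isPainted empty = 0
isPainted one   = 1
isPainted two   = 1

isOne : Slot → ℕ
isOne one = 1
isOne _   = 0

painted : ∀ {m} → Grid m → ℕ
painted [] = 0
painted ((a , b) ∷ cs) = isPainted a + isPainted b + painted cs

-- number of slots of color one (the i of the type (i , j))
colorOneCount : ∀ {m} → Grid m → ℕ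
colorOneCount [] = 0
colorOneCount ((a , b) ∷ cs) = isOne a + isOne b + colorOneCount cs

monochrome : Column → Bool
monochrome (one , two) = false
monochrome (two , one) = false
monochrome _ = true

allCols : ∀ {m} → (Column → Bool) → Grid m → Bool
allCols p [] = true
allCols p (c ∷ cs) = p c ∧ allCols p cs

isConfig : ∀ {n} → Grid n → Bool
isConfig {n} g = (painted g ≡ᵇ n) ∧ allCols monochrome g

isTower : Column → Bool
isTower (empty , _) = false
isTower (_ , empty) = false
isTower _ = true

noTower : Column → Bool
noTower c = not (isTower c)

noTwo : Column → Bool
noTwo (two , _) = false
noTwo (_ , two) = false
noTwo _ = true

noOne : Column → Bool
noOne (one , _) = false
noOne (_ , one) = false
noOne _ = true

splitOrdered : ∀ {m} → ℕ → Grid m → Bool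
splitOrdered zero cs = allCols noOne cs
splitOrdered (suc i) [] = true
splitOrdered (suc i) (c ∷ cs) = noTwo c ∧ splitOrdered i cs

-- An n-configuration of type (i , j) (i = number of color-one slots) is
-- ordered if all color-one slots lie in the first i columns and all
-- color-two slots lie in the last j = n - i columns.
isOrdered : ∀ {n} → Grid n → Bool
isOrdered g = isConfig g ∧ splitOrdered (colorOneCount g) g

Ordered : ℕ → Set
Ordered n = Σ (Grid n) (λ g → T (isOrdered g))

TowerFree : ℕ → Set
TowerFree n = Σ (Grid n) (λ g → T (isConfig g ∧ allCols noTower g))

module Submission where

-- Both sets are cut out of the finite set of 2 × n grids by a Boolean predicate,
-- so each is in bijection with Fin of its number of elements (enumerate); it
-- therefore suffices to show that both have 4ⁿ elements.
--
-- The absorption identity for binomial coefficients gives the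
--    recurrence (k+1)·C(2k+2,k+1) = 2(2k+1)·C(2k,k), from which a symmetry
--    argument on convolutions yields  Σ_{i+j=n} C(2i,i)·C(2j,j) = 4ⁿ.
--  * Counting grids.  sumGrids sums a weight over all grids; it is linear and
--    satisfies Fubini for a grid cut into a left and a right block of columns.
--  * 𝒪ₙ.  An ordered configuration of type (i , j) is a block of i columns with
--    i slots of colour one followed by a block of j columns with j slots of
--    colour two; there are C(2i,i)·C(2j,j) of them.  Summing over the types gives 4ⁿ.
--  * 𝒯ₙ.  A tower-free n-configuration has exactly one painted slot in each
--    column, chosen among 4 possibilities, giving 4ⁿ.

open import Defs
open import Data.Bool using (Bool; true; false; _∧_; T)
open import Data.Bool.Properties using (∧-assoc; ∧-zeroʳ; T-∧)
open import Data.Nat using (ℕ; zero; suc; _+_; _*_; _^_; _∸_; _≤_; _<_; _≥_; _≡ᵇ_; s≤s; z≤n)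
open import Data.Nat.Properties
  using ( +-assoc; +-comm; +-suc; +-identityʳ; +-cancelˡ-≡; +-mono-≤; *-suc; *-zeroʳ; *-identityʳ
        ; *-comm; *-assoc; *-distribˡ-+; *-distribʳ-+; *-cancelˡ-≡; m≤m+n; m+n∸m≡n; m+[n∸m]≡n
        ; ≤-pred; ≡ᵇ⇒≡; ≡⇒≡ᵇ )
open import Data.Nat.Combinatorics using (_C_; nCk+nC[k+1]≡[n+1]C[k+1]; nCk≡nC[n∸k]; nC1≡n)
open import Data.Nat.Tactic.RingSolver using (solve-∀)
open import Data.Product using (Σ; _×_; _,_; proj₁; proj₂)
open import Data.Sum using (_⊎_; inj₁; inj₂)
open import Data.Sum.Function.Propositional using (_⊎-↔_)
open import Data.Unit using (tt)
open import Data.Empty using (⊥-elim)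
open import Data.Fin using (Fin)
open import Data.Fin.Properties using (+↔⊎)
open import Data.Vec using ([]; _∷_; _++_; map)
open import Function.Base using (_∘_)
open import Function.Bundles using (_↔_; _⤖_; Equivalence; mk↔ₛ′)
open import Function.Properties.Inverse using (↔-sym; ↔-trans; ↔-refl; ↔⇒⤖)
open import Relation.Binary.PropositionalEquality
  using (_≡_; refl; sym; trans; cong; cong₂; subst; module ≡-Reasoning)
open ≡-Reasoning

absorption : ∀ n k → suc k * (suc n C suc k) ≡ suc n * (n C k)
absorption zero    zero    = refl
absorption zero    (suc k) = *-zeroʳ (suc (suc k))
absorption (suc n) zero    =
  trans (+-identityʳ _) (trans (nC1≡n (suc (suc n))) (sym (*-identityʳ (suc (suc n)))))
absorption (suc n) (suc k) = begin
  suc (suc k) * (suc (suc n) C suc (suc k))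
    ≡⟨ cong (suc (suc k) *_) (sym (nCk+nC[k+1]≡[n+1]C[k+1] (suc n) (suc k))) ⟩
  suc (suc k) * (P + Q)
    ≡⟨ regroup (suc k) P Q ⟩
  suc k * P + P + suc (suc k) * Q
    ≡⟨ cong₂ (λ x y → x + P + y) (absorption n k) (absorption n (suc k)) ⟩
  suc n * (n C k) + P + suc n * (n C suc k)
    ≡⟨ cong (λ x → suc n * (n C k) + x + suc n * (n C suc k)) (sym (nCk+nC[k+1]≡[n+1]C[k+1] n k)) ⟩
  suc n * (n C k) + (n C k + n C suc k) + suc n * (n C suc k)
    ≡⟨ collect (suc n) (n C k) (n C suc k) ⟩
  suc (suc n) * (n C k + n C suc k)
    ≡⟨ cong (suc (suc n) *_) (nCk+nC[k+1]≡[n+1]C[k+1] n k) ⟩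
  suc (suc n) * P ∎
  where
  P = suc n C suc k
  Q = suc n C suc (suc k)
  regroup : ∀ k P Q → suc k * (P + Q) ≡ k * P + P + suc k * Q
  regroup = solve-∀
  collect : ∀ m x y → m * x + (x + y) + m * y ≡ suc m * (x + y)
  collect = solve-∀

pascal² : ∀ n q → n C suc (suc q) + 2 * (n C suc q) + n C q ≡ suc (suc n) C suc (suc q)
pascal² n q = begin
  n C suc (suc q) + 2 * (n C suc q) + n C q
    ≡⟨ regroup (n C q) (n C suc q) (n C suc (suc q)) ⟩
  (n C q + n C suc q) + (n C suc q + n C suc (suc q))
    ≡⟨ cong₂ _+_ (nCk+nC[k+1]≡[n+1]C[k+1] n q) (nCk+nC[k+1]≡[n+1]C[k+1] n (suc q)) ⟩
  suc n C suc q + suc n C suc (suc q)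
    ≡⟨ nCk+nC[k+1]≡[n+1]C[k+1] (suc n) (suc q) ⟩
  suc (suc n) C suc (suc q) ∎
  where
  regroup : ∀ x y z → z + 2 * y + x ≡ (x + y) + (y + z)
  regroup = solve-∀

central : ℕ → ℕ
central k = (2 * k) C k

central-recurrence : ∀ k → suc k * central (suc k) ≡ 2 * (suc (2 * k) * central k)
central-recurrence k = begin
  suc k * ((2 * suc k) C suc k)  ≡⟨ cong (λ m → suc k * (m C suc k)) (*-suc 2 k) ⟩
  suc k * (suc (suc d) C suc k)  ≡⟨ cong (suc k *_) (sym (nCk+nC[k+1]≡[n+1]C[k+1] (suc d) k)) ⟩
  suc k * (suc d C k + Y)        ≡⟨ cong (λ x → suc k * (x + Y)) symmetric ⟩
  suc k * (Y + Y)                ≡⟨ double (suc k) Y ⟩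
  2 * (suc k * Y)                ≡⟨ cong (2 *_) (absorption d k) ⟩
  2 * (suc d * central k)        ∎
  where
  d = 2 * k
  Y = suc d C suc k
  symmetric : suc d C k ≡ Y
  symmetric = trans (cong (suc d C_) (sym (trans (m+n∸m≡n k (k + 0)) (+-identityʳ k))))
                    (sym (nCk≡nC[n∸k] (s≤s (m≤m+n k (k + 0)))))
  double : ∀ m y → m * (y + y) ≡ 2 * (m * y)
  double = solve-∀

conv : (ℕ → ℕ) → (ℕ → ℕ) → ℕ → ℕ
conv f g zero    = f 0 * g 0
conv f g (suc n) = f 0 * g (suc n) + conv (λ i → f (suc i)) g n

conv-cong : ∀ n {f f′ g : ℕ → ℕ} → (∀ i → f i ≡ f′ i) → conv f g n ≡ conv f′ g n
conv-cong zero    f≡f′ = cong (_* _) (f≡f′ 0)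
conv-cong (suc n) f≡f′ = cong₂ _+_ (cong (_* _) (f≡f′ 0)) (conv-cong n (λ i → f≡f′ (suc i)))

conv-+ : ∀ n (f f′ g : ℕ → ℕ) → conv (λ i → f i + f′ i) g n ≡ conv f g n + conv f′ g n
conv-+ zero    f f′ g = *-distribʳ-+ (g 0) (f 0) (f′ 0)
conv-+ (suc n) f f′ g =
  trans (cong₂ _+_ (*-distribʳ-+ (g (suc n)) (f 0) (f′ 0)) (conv-+ n (λ i → f (suc i)) (λ i → f′ (suc i)) g))
        (swap-middle (f 0 * g (suc n)) (f′ 0 * g (suc n)) _ _)
  where
  swap-middle : ∀ x y z w → (x + y) + (z + w) ≡ (x + z) + (y + w)
  swap-middle = solve-∀

conv-*ˡ : ∀ n c (f g : ℕ → ℕ) → conv (λ i → c * f i) g n ≡ c * conv f g n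
conv-*ˡ zero    c f g = *-assoc c (f 0) (g 0)
conv-*ˡ (suc n) c f g =
  trans (cong₂ _+_ (*-assoc c (f 0) (g (suc n))) (conv-*ˡ n c (λ i → f (suc i)) g))
        (sym (*-distribˡ-+ c _ _))

conv-last : ∀ n (f g : ℕ → ℕ) → conv f g (suc n) ≡ conv f (λ j → g (suc j)) n + f (suc n) * g 0
conv-last zero    f g = refl
conv-last (suc n) f g =
  trans (cong (f 0 * g (suc (suc n)) +_) (conv-last n (λ i → f (suc i)) g))
        (sym (+-assoc (f 0 * g (suc (suc n))) _ _))

conv-comm : ∀ n (f g : ℕ → ℕ) → conv f g n ≡ conv g f n
conv-comm zero    f g = *-comm (f 0) (g 0)
conv-comm (suc n) f g = begin
  f 0 * g (suc n) + conv (λ i → f (suc i)) g n  ≡⟨ cong (f 0 * g (suc n) +_) (conv-comm n (λ i → f (suc i)) g) ⟩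
  f 0 * g (suc n) + conv g (λ i → f (suc i)) n  ≡⟨ +-comm (f 0 * g (suc n)) _ ⟩
  conv g (λ i → f (suc i)) n + f 0 * g (suc n)  ≡⟨ cong (conv g (λ i → f (suc i)) n +_) (*-comm (f 0) (g (suc n))) ⟩
  conv g (λ i → f (suc i)) n + g (suc n) * f 0  ≡⟨ sym (conv-last n g f) ⟩
  conv g f (suc n)                              ∎

-- Σ_{i+j=n} (i + j)·f i·g j = n · Σ_{i+j=n} f i·g j, split into its two halves.
conv-weighted : ∀ n (f g : ℕ → ℕ) →
                conv (λ i → i * f i) g n + conv f (λ j → j * g j) n ≡ n * conv f g n
conv-weighted zero    f g = *-zeroʳ (f 0)
conv-weighted (suc n) f g = begin
  conv (λ i → suc i * f′ i) g n + (f 0 * (suc n * g (suc n)) + conv f′ (λ j → j * g j) n)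
    ≡⟨ cong (_+ (f 0 * (suc n * g (suc n)) + conv f′ (λ j → j * g j) n)) (conv-+ n f′ (λ i → i * f′ i) g) ⟩
  (X + conv (λ i → i * f′ i) g n) + (f 0 * (suc n * g (suc n)) + conv f′ (λ j → j * g j) n)
    ≡⟨ regroup X (conv (λ i → i * f′ i) g n) (f 0 * (suc n * g (suc n))) (conv f′ (λ j → j * g j) n) ⟩
  X + f 0 * (suc n * g (suc n)) + (conv (λ i → i * f′ i) g n + conv f′ (λ j → j * g j) n)
    ≡⟨ cong (X + f 0 * (suc n * g (suc n)) +_) (conv-weighted n f′ g) ⟩
  X + f 0 * (suc n * g (suc n)) + n * X
    ≡⟨ collect n X (f 0) (g (suc n)) ⟩
  suc n * (f 0 * g (suc n) + X) ∎
  where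
  f′ = λ i → f (suc i)
  X = conv f′ g n
  regroup : ∀ x y z w → (x + y) + (z + w) ≡ x + z + (y + w)
  regroup = solve-∀
  collect : ∀ n x p q → x + p * (suc n * q) + n * x ≡ suc n * (p * q + x)
  collect = solve-∀

-- The classical identity  Σ_{i+j=n} C(2i,i)·C(2j,j) = 4ⁿ.
-- With S n the left side and W n = Σ_{i+j=n} i·c_i·c_j, symmetry gives 2·W n = n·S n,
-- and the recurrence for c gives W (n+1) = 2(n+1)·S n; hence (n+1)·S(n+1) = 4(n+1)·S n.
module CentralConvolution where

  S W : ℕ → ℕ
  S n = conv central central n
  W n = conv (λ i → i * central i) central n

  twice-W : ∀ n → 2 * W n ≡ n * S n
  twice-W n = trans (cong (W n +_) (trans (+-identityʳ (W n)) (conv-comm n (λ i → i * central i) central)))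
                    (conv-weighted n central central)

  W-suc : ∀ n → W (suc n) ≡ 2 * (suc n * S n)
  W-suc n = begin
    conv (λ i → suc i * central (suc i)) central n
      ≡⟨ conv-cong n (λ i → trans (central-recurrence i) (cong (2 *_) (expand i (central i)))) ⟩
    conv (λ i → 2 * (central i + 2 * (i * central i))) central n
      ≡⟨ conv-*ˡ n 2 _ central ⟩
    2 * conv (λ i → central i + 2 * (i * central i)) central n
      ≡⟨ cong (2 *_) (conv-+ n central _ central) ⟩
    2 * (S n + conv (λ i → 2 * (i * central i)) central n)
      ≡⟨ cong (λ x → 2 * (S n + x)) (trans (conv-*ˡ n 2 _ central) (twice-W n)) ⟩
    2 * (S n + n * S n) ∎
    where
    expand : ∀ i x → suc (2 * i) * x ≡ x + 2 * (i * x)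
    expand = solve-∀

  S≡4^ : ∀ n → S n ≡ 4 ^ n
  S≡4^ zero    = refl
  S≡4^ (suc n) = trans (*-cancelˡ-≡ (S (suc n)) (4 * S n) (suc n) (begin
    suc n * S (suc n)        ≡⟨ sym (twice-W (suc n)) ⟩
    2 * W (suc n)            ≡⟨ cong (2 *_) (W-suc n) ⟩
    2 * (2 * (suc n * S n))  ≡⟨ rearrange n (S n) ⟩
    suc n * (4 * S n)        ∎))
    (cong (4 *_) (S≡4^ n))
    where
    rearrange : ∀ n s → 2 * (2 * (suc n * s)) ≡ suc n * (4 * s)
    rearrange = solve-∀

open CentralConvolution using (S≡4^)

sumTo : ℕ → (ℕ → ℕ) → ℕ
sumTo zero    h = 0
sumTo (suc K) h = h 0 + sumTo K (λ i → h (suc i))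

sumTo-cong : ∀ K {h h′ : ℕ → ℕ} → (∀ i → i < K → h i ≡ h′ i) → sumTo K h ≡ sumTo K h′
sumTo-cong zero    h≡h′ = refl
sumTo-cong (suc K) h≡h′ = cong₂ _+_ (h≡h′ 0 (s≤s z≤n)) (sumTo-cong K (λ i i<K → h≡h′ (suc i) (s≤s i<K)))

sumTo-zero : ∀ K → sumTo K (λ _ → 0) ≡ 0
sumTo-zero zero    = refl
sumTo-zero (suc K) = sumTo-zero K

conv-sumTo : ∀ n (f g : ℕ → ℕ) → conv f g n ≡ sumTo (suc n) (λ i → f i * g (n ∸ i))
conv-sumTo zero    f g = sym (+-identityʳ _)
conv-sumTo (suc n) f g = cong (f 0 * g (suc n) +_) (conv-sumTo n (λ i → f (suc i)) g)

𝟙 : Bool → ℕ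
𝟙 true  = 1
𝟙 false = 0

sumSlots : (Slot → ℕ) → ℕ
sumSlots f = f empty + (f one + f two)

col : ∀ {m} → Slot → Slot → Grid m → Grid (suc m)
col a b g = (a , b) ∷ g

sumGrids : ∀ m → (Grid m → ℕ) → ℕ
sumGrids zero    w = w []
sumGrids (suc m) w = sumSlots λ a → sumSlots λ b → sumGrids m (w ∘ col a b)

count : ∀ m → (Grid m → Bool) → ℕ
count m P = sumGrids m (λ g → 𝟙 (P g))

module Enumeration where

  T↔Fin : (b : Bool) → T b ↔ Fin (𝟙 b)
  T↔Fin true  = mk↔ₛ′ (λ _ → Fin.zero) (λ _ → tt) (λ { Fin.zero → refl ; (Fin.suc ()) }) (λ _ → refl)
  T↔Fin false = mk↔ₛ′ (λ ()) (λ ()) (λ ()) (λ ())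

  Σ-Slot↔ : (F : Slot → Set) (f : Slot → ℕ) → (∀ s → F s ↔ Fin (f s)) →
            Σ Slot F ↔ Fin (sumSlots f)
  Σ-Slot↔ F f F↔f = ↔-trans Σ↔⊎ (↔-trans (F↔f empty ⊎-↔ (F↔f one ⊎-↔ F↔f two))
                      (↔-sym (↔-trans +↔⊎ (↔-refl ⊎-↔ +↔⊎))))
    where
    Σ↔⊎ : Σ Slot F ↔ (F empty ⊎ (F one ⊎ F two))
    Σ↔⊎ = mk↔ₛ′ to from to∘from from∘to
      where
      to : Σ Slot F → F empty ⊎ (F one ⊎ F two)
      to (empty , x) = inj₁ x
      to (one   , x) = inj₂ (inj₁ x)
      to (two   , x) = inj₂ (inj₂ x)
      from : F empty ⊎ (F one ⊎ F two) → Σ Slot F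
      from (inj₁ x)        = empty , x
      from (inj₂ (inj₁ x)) = one , x
      from (inj₂ (inj₂ x)) = two , x
      to∘from : ∀ y → to (from y) ≡ y
      to∘from (inj₁ x)        = refl
      to∘from (inj₂ (inj₁ x)) = refl
      to∘from (inj₂ (inj₂ x)) = refl
      from∘to : ∀ y → from (to y) ≡ y
      from∘to (empty , x) = refl
      from∘to (one   , x) = refl
      from∘to (two   , x) = refl

  uncons↔ : ∀ m (P : Grid (suc m) → Bool) →
            Σ (Grid (suc m)) (λ g → T (P g)) ↔
            Σ Slot λ a → Σ Slot λ b → Σ (Grid m) (λ g → T (P ((a , b) ∷ g)))
  uncons↔ m P = mk↔ₛ′ (λ { (((a , b) ∷ g) , t) → a , b , g , t })
                      (λ { (a , b , g , t) → ((a , b) ∷ g) , t })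
                      (λ _ → refl) (λ { (((a , b) ∷ g) , t) → refl })

  enumerate : ∀ m (P : Grid m → Bool) → Σ (Grid m) (λ g → T (P g)) ↔ Fin (count m P)
  enumerate zero P = ↔-trans (mk↔ₛ′ (λ { ([] , t) → t }) (λ t → [] , t) (λ _ → refl) (λ { ([] , t) → refl }))
                             (T↔Fin (P []))
  enumerate (suc m) P = ↔-trans (uncons↔ m P)
    (Σ-Slot↔ _ _ λ a → Σ-Slot↔ _ _ λ b → enumerate m (λ g → P ((a , b) ∷ g)))

open Enumeration using (enumerate) public

sumSlots-cong : ∀ {f f′ : Slot → ℕ} → (∀ s → f s ≡ f′ s) → sumSlots f ≡ sumSlots f′
sumSlots-cong f≡f′ = cong₂ _+_ (f≡f′ empty) (cong₂ _+_ (f≡f′ one) (f≡f′ two))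

sumGrids-cong : ∀ m {w w′ : Grid m → ℕ} → (∀ g → w g ≡ w′ g) → sumGrids m w ≡ sumGrids m w′
sumGrids-cong zero    w≡w′ = w≡w′ []
sumGrids-cong (suc m) w≡w′ =
  sumSlots-cong λ a → sumSlots-cong λ b → sumGrids-cong m (λ g → w≡w′ (col a b g))

sumGrids-+ : ∀ m (v w : Grid m → ℕ) → sumGrids m (λ g → v g + w g) ≡ sumGrids m v + sumGrids m w
sumGrids-+ zero    v w = refl
sumGrids-+ (suc m) v w = trans
  (sumSlots-cong λ a → trans (sumSlots-cong λ b → sumGrids-+ m (v ∘ col a b) (w ∘ col a b))
                                (sumSlots-+ (λ b → sumGrids m (v ∘ col a b)) (λ b → sumGrids m (w ∘ col a b))))
  (sumSlots-+ (λ a → sumSlots λ b → sumGrids m (v ∘ col a b)) (λ a → sumSlots λ b → sumGrids m (w ∘ col a b)))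
  where
  sumSlots-+ : ∀ (f f′ : Slot → ℕ) → sumSlots (λ s → f s + f′ s) ≡ sumSlots f + sumSlots f′
  sumSlots-+ f f′ = shuffle (f empty) (f one) (f two) (f′ empty) (f′ one) (f′ two)
    where
    shuffle : ∀ x y z x′ y′ z′ → (x + x′) + ((y + y′) + (z + z′)) ≡ (x + (y + z)) + (x′ + (y′ + z′))
    shuffle = solve-∀

sumGrids-*ˡ : ∀ m c (w : Grid m → ℕ) → sumGrids m (λ g → c * w g) ≡ c * sumGrids m w
sumGrids-*ˡ zero    c w = refl
sumGrids-*ˡ (suc m) c w = trans
  (sumSlots-cong λ a → trans (sumSlots-cong λ b → sumGrids-*ˡ m c (w ∘ col a b))
                                (sumSlots-*ˡ (λ b → sumGrids m (w ∘ col a b))))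
  (sumSlots-*ˡ (λ a → sumSlots λ b → sumGrids m (w ∘ col a b)))
  where
  sumSlots-*ˡ : ∀ (f : Slot → ℕ) → sumSlots (λ s → c * f s) ≡ c * sumSlots f
  sumSlots-*ˡ f = sym (trans (*-distribˡ-+ c _ _) (cong (c * f empty +_) (*-distribˡ-+ c _ _)))

sumGrids-zero : ∀ m → sumGrids m (λ _ → 0) ≡ 0
sumGrids-zero m = sumGrids-*ˡ m 0 (λ _ → 0)

count-∧false : ∀ m (P : Grid m → Bool) → count m (λ g → P g ∧ false) ≡ 0
count-∧false m P = trans (sumGrids-cong m (λ g → cong 𝟙 (∧-zeroʳ (P g)))) (sumGrids-zero m)

sumGrids-++ : ∀ s t (w : Grid (s + t) → ℕ) →
              sumGrids (s + t) w ≡ sumGrids s (λ h → sumGrids t (λ k → w (h ++ k)))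
sumGrids-++ zero    t w = refl
sumGrids-++ (suc s) t w = sumSlots-cong λ a → sumSlots-cong λ b → sumGrids-++ s t (w ∘ col a b)

sumGrids-product : ∀ s t (u : Grid s → ℕ) (v : Grid t → ℕ) →
                   sumGrids s (λ h → sumGrids t (λ k → u h * v k)) ≡ sumGrids s u * sumGrids t v
sumGrids-product s t u v = begin
  sumGrids s (λ h → sumGrids t (λ k → u h * v k)) ≡⟨ sumGrids-cong s (λ h → sumGrids-*ˡ t (u h) v) ⟩
  sumGrids s (λ h → u h * V)                      ≡⟨ sumGrids-cong s (λ h → *-comm (u h) V) ⟩
  sumGrids s (λ h → V * u h)                      ≡⟨ sumGrids-*ˡ s V u ⟩
  V * sumGrids s u                                ≡⟨ *-comm V _ ⟩
  sumGrids s u * V                                ∎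
  where V = sumGrids t v

sumGrids-sumTo : ∀ m K (w : ℕ → Grid m → ℕ) →
                 sumGrids m (λ g → sumTo K (λ i → w i g)) ≡ sumTo K (λ i → sumGrids m (w i))
sumGrids-sumTo m zero    w = sumGrids-zero m
sumGrids-sumTo m (suc K) w = trans (sumGrids-+ m (w 0) (λ g → sumTo K (λ i → w (suc i) g)))
                                   (cong (sumGrids m (w 0) +_) (sumGrids-sumTo m K (λ i → w (suc i))))

T-ext : ∀ {x y} → (T x → T y) → (T y → T x) → x ≡ y
T-ext {true}  {true}  _ _ = refl
T-ext {true}  {false} f _ = ⊥-elim (f tt)
T-ext {false} {true}  _ g = ⊥-elim (g tt)
T-ext {false} {false} _ _ = refl

𝟙-∧ : ∀ x y → 𝟙 (x ∧ y) ≡ 𝟙 x * 𝟙 y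
𝟙-∧ true  true  = refl
𝟙-∧ true  false = refl
𝟙-∧ false y     = refl

∧-split : ∀ {x y} → T (x ∧ y) → T x × T y
∧-split = Equivalence.to T-∧

∧-pair : ∀ {x y} → T x → T y → T (x ∧ y)
∧-pair p q = Equivalence.from T-∧ (p , q)

painted-++ : ∀ {i j} (h : Grid i) (k : Grid j) → painted (h ++ k) ≡ painted h + painted k
painted-++ []              k = refl
painted-++ ((a , b) ∷ h) k = trans (cong (isPainted a + isPainted b +_) (painted-++ h k))
                                   (sym (+-assoc (isPainted a + isPainted b) _ _))

colorOneCount-++ : ∀ {i j} (h : Grid i) (k : Grid j) →
                   colorOneCount (h ++ k) ≡ colorOneCount h + colorOneCount k
colorOneCount-++ []              k = refl
colorOneCount-++ ((a , b) ∷ h) k = trans (cong (isOne a + isOne b +_) (colorOneCount-++ h k))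
                                         (sym (+-assoc (isOne a + isOne b) _ _))

allCols-++ : ∀ p {i j} (h : Grid i) (k : Grid j) → allCols p (h ++ k) ≡ allCols p h ∧ allCols p k
allCols-++ p []      k = refl
allCols-++ p (c ∷ h) k = trans (cong (p c ∧_) (allCols-++ p h k)) (sym (∧-assoc (p c) _ _))

splitOrdered-++ : ∀ {i j} (h : Grid i) (k : Grid j) →
                  splitOrdered i (h ++ k) ≡ allCols noTwo h ∧ allCols noOne k
splitOrdered-++ []      k = refl
splitOrdered-++ (c ∷ h) k = trans (cong (noTwo c ∧_) (splitOrdered-++ h k)) (sym (∧-assoc (noTwo c) _ _))

allCols-weaken : ∀ {p q : Column → Bool} → (∀ c → T (p c) → T (q c)) →
                 ∀ {m} (g : Grid m) → T (allCols p g) → T (allCols q g)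
allCols-weaken p⇒q []      _ = tt
allCols-weaken p⇒q (c ∷ g) t = ∧-pair (p⇒q c (proj₁ (∧-split t))) (allCols-weaken p⇒q g (proj₂ (∧-split t)))

noTwo⇒monochrome : ∀ c → T (noTwo c) → T (monochrome c)
noTwo⇒monochrome (one , two) ()
noTwo⇒monochrome (two , _)   ()
noTwo⇒monochrome (empty , empty) _ = tt
noTwo⇒monochrome (empty , one)   _ = tt
noTwo⇒monochrome (empty , two)   ()
noTwo⇒monochrome (one , empty)   _ = tt
noTwo⇒monochrome (one , one)     _ = tt

noOne⇒monochrome : ∀ c → T (noOne c) → T (monochrome c)
noOne⇒monochrome (one , _)       ()
noOne⇒monochrome (two , one)     ()
noOne⇒monochrome (empty , empty) _ = tt
noOne⇒monochrome (empty , one)   ()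
noOne⇒monochrome (empty , two)   _ = tt
noOne⇒monochrome (two , empty)   _ = tt
noOne⇒monochrome (two , two)     _ = tt

noTwo⇒colorOne≡painted : ∀ {m} (h : Grid m) → T (allCols noTwo h) → colorOneCount h ≡ painted h
noTwo⇒colorOne≡painted []              _ = refl
noTwo⇒colorOne≡painted ((a , b) ∷ h) t =
  cong₂ _+_ (column a b (proj₁ (∧-split t))) (noTwo⇒colorOne≡painted h (proj₂ (∧-split t)))
  where
  column : ∀ a b → T (noTwo (a , b)) → isOne a + isOne b ≡ isPainted a + isPainted b
  column empty empty _ = refl
  column empty one   _ = refl
  column empty two   ()
  column one   empty _ = refl
  column one   one   _ = refl
  column one   two   ()
  column two   _     ()

noOne⇒colorOne≡0 : ∀ {m} (k : Grid m) → T (allCols noOne k) → colorOneCount k ≡ 0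
noOne⇒colorOne≡0 []              _ = refl
noOne⇒colorOne≡0 ((a , b) ∷ k) t =
  cong₂ _+_ (column a b (proj₁ (∧-split t))) (noOne⇒colorOne≡0 k (proj₂ (∧-split t)))
  where
  column : ∀ a b → T (noOne (a , b)) → isOne a + isOne b ≡ 0
  column empty empty _ = refl
  column empty one   ()
  column empty two   _ = refl
  column one   _     ()
  column two   empty _ = refl
  column two   one   ()
  column two   two   _ = refl

OnlyOne OnlyTwo : ∀ {m} → ℕ → Grid m → Bool
OnlyOne p h = allCols noTwo h ∧ (painted h ≡ᵇ p)
OnlyTwo p k = allCols noOne k ∧ (painted k ≡ᵇ p)

ordered-of-type : ∀ {i j} (h : Grid i) (k : Grid j) →
                  (isOrdered (h ++ k) ∧ (colorOneCount (h ++ k) ≡ᵇ i)) ≡ (OnlyOne i h ∧ OnlyTwo j k)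
ordered-of-type {i} {j} h k = T-ext forward backward
  where
  g = h ++ k

  colorOne≡ : T (allCols noTwo h) → T (allCols noOne k) → colorOneCount g ≡ painted h
  colorOne≡ h₁ k₂ = trans (colorOneCount-++ h k)
    (trans (cong₂ _+_ (noTwo⇒colorOne≡painted h h₁) (noOne⇒colorOne≡0 k k₂)) (+-identityʳ _))

  forward : T (isOrdered g ∧ (colorOneCount g ≡ᵇ i)) → T (OnlyOne i h ∧ OnlyTwo j k)
  forward t = ∧-pair (∧-pair h₁ (≡⇒≡ᵇ _ _ painted-h)) (∧-pair k₂ (≡⇒≡ᵇ _ _ painted-k))
    where
    ordered = proj₁ (∧-split t)
    type-i  = ≡ᵇ⇒≡ _ _ (proj₂ (∧-split {isOrdered g} t))
    config  = proj₁ (∧-split {isConfig g} ordered)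
    blocks  = ∧-split (subst T (splitOrdered-++ h k)
                (subst (λ c → T (splitOrdered c g)) type-i (proj₂ (∧-split {isConfig g} ordered))))
    h₁ = proj₁ blocks
    k₂ = proj₂ blocks
    painted-h : painted h ≡ i
    painted-h = trans (sym (colorOne≡ h₁ k₂)) type-i
    painted-k : painted k ≡ j
    painted-k = +-cancelˡ-≡ i _ _ (begin
      i + painted k          ≡⟨ cong (_+ painted k) (sym painted-h) ⟩
      painted h + painted k  ≡⟨ sym (painted-++ h k) ⟩
      painted g              ≡⟨ ≡ᵇ⇒≡ _ _ (proj₁ (∧-split {painted g ≡ᵇ i + j} config)) ⟩
      i + j                  ∎)

  backward : T (OnlyOne i h ∧ OnlyTwo j k) → T (isOrdered g ∧ (colorOneCount g ≡ᵇ i))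
  backward t = ∧-pair (∧-pair (∧-pair (≡⇒≡ᵇ _ _ painted-g) monochrome-g) split-g) (≡⇒≡ᵇ _ _ type-i)
    where
    left  = ∧-split {allCols noTwo h} (proj₁ (∧-split {OnlyOne i h} t))
    right = ∧-split {allCols noOne k} (proj₂ (∧-split {OnlyOne i h} t))
    h₁ = proj₁ left
    k₂ = proj₁ right
    type-i : colorOneCount g ≡ i
    type-i = trans (colorOne≡ h₁ k₂) (≡ᵇ⇒≡ _ _ (proj₂ left))
    painted-g : painted g ≡ i + j
    painted-g = trans (painted-++ h k)
      (cong₂ _+_ (≡ᵇ⇒≡ (painted h) i (proj₂ left)) (≡ᵇ⇒≡ (painted k) j (proj₂ right)))
    monochrome-g : T (allCols monochrome g)
    monochrome-g = subst T (sym (allCols-++ monochrome h k))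
      (∧-pair (allCols-weaken noTwo⇒monochrome h h₁) (allCols-weaken noOne⇒monochrome k k₂))
    split-g : T (splitOrdered (colorOneCount g) g)
    split-g = subst (λ c → T (splitOrdered c g)) (sym type-i)
                (subst T (sym (splitOrdered-++ h k)) (∧-pair h₁ k₂))

-- Counting one-coloured blocks: count m (OnlyOne p) = C(2m, p), a choice of p of
-- the 2m slots.  Splitting off the first column leaves p, p-1 or p-2 slots to paint.
shifted : ∀ m → ℕ → ℕ → ℕ
shifted m d p = count m (λ h → allCols noTwo h ∧ (d + painted h ≡ᵇ p))

-- The first column is empty, has one slot of colour one (in two ways) or two;
-- columns containing colour two contribute nothing.
countOne-step : ∀ m p → count (suc m) (OnlyOne p) ≡ count m (OnlyOne p) + 2 * shifted m 1 p + shifted m 2 p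
countOne-step m p rewrite sumGrids-zero m = arithmetic (count m (OnlyOne p)) (shifted m 1 p) (shifted m 2 p)
  where
  arithmetic : ∀ x y z → (x + (y + 0)) + ((y + (z + 0)) + (0 + (0 + 0))) ≡ x + 2 * y + z
  arithmetic = solve-∀

countOne : ∀ m p → count m (OnlyOne p) ≡ (2 * m) C p
countOne zero    zero    = refl
countOne zero    (suc p) = refl
countOne (suc m) p rewrite countOne-step m p | *-suc 2 m = columns p
  where
  -- At least one slot of the first column is painted, but none may be.
  no-room : shifted m 1 0 ≡ 0
  no-room = count-∧false m (allCols noTwo)
  columns : ∀ p → count m (OnlyOne p) + 2 * shifted m 1 p + shifted m 2 p ≡ suc (suc (2 * m)) C p
  columns zero
    rewrite countOne m 0 | no-room = refl
  columns (suc zero)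
    rewrite countOne m 1 | countOne m 0 | no-room | nC1≡n (2 * m) | nC1≡n (suc (suc (2 * m))) = two-more (2 * m)
    where
    two-more : ∀ n → n + 2 + 0 ≡ suc (suc n)
    two-more = solve-∀
  columns (suc (suc q))
    rewrite countOne m (suc (suc q)) | countOne m (suc q) | countOne m q = pascal² (2 * m) q

-- Exchanging the two colours is a symmetry of the set of grids, mapping blocks
-- of colour one to blocks of colour two; so countTwo follows from countOne.
swapSlot : Slot → Slot
swapSlot empty = empty
swapSlot one   = two
swapSlot two   = one

swapGrid : ∀ {m} → Grid m → Grid m
swapGrid = map λ { (a , b) → swapSlot a , swapSlot b }

sumGrids-swap : ∀ m (w : Grid m → ℕ) → sumGrids m (w ∘ swapGrid) ≡ sumGrids m w
sumGrids-swap zero    w = refl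
sumGrids-swap (suc m) w = begin
  sumSlots (λ a → sumSlots λ b → sumGrids m (λ g → w (col (swapSlot a) (swapSlot b) (swapGrid g))))
    ≡⟨ sumSlots-cong (λ a → sumSlots-cong λ b → sumGrids-swap m (w ∘ col (swapSlot a) (swapSlot b))) ⟩
  sumSlots (λ a → sumSlots λ b → F (swapSlot a) (swapSlot b))
    ≡⟨ sumSlots-cong (λ a → sumSlots-swap (F (swapSlot a))) ⟩
  sumSlots (λ a → sumSlots λ b → F (swapSlot a) b)
    ≡⟨ sumSlots-swap (λ a → sumSlots (F a)) ⟩
  sumSlots (λ a → sumSlots λ b → F a b) ∎
  where
  F : Slot → Slot → ℕ
  F a b = sumGrids m (w ∘ col a b)
  sumSlots-swap : ∀ f → sumSlots (f ∘ swapSlot) ≡ sumSlots f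
  sumSlots-swap f = cong (f empty +_) (+-comm (f two) (f one))

OnlyTwo-swap : ∀ {m} p (h : Grid m) → OnlyTwo p (swapGrid h) ≡ OnlyOne p h
OnlyTwo-swap p h = cong₂ _∧_ (noOne-swap h) (cong (_≡ᵇ p) (painted-swap h))
  where
  noOne-swap : ∀ {m} (h : Grid m) → allCols noOne (swapGrid h) ≡ allCols noTwo h
  noOne-swap [] = refl
  noOne-swap ((a , b) ∷ h) = cong₂ _∧_ (column a b) (noOne-swap h)
    where
    column : ∀ a b → noOne (swapSlot a , swapSlot b) ≡ noTwo (a , b)
    column empty empty = refl
    column empty one   = refl
    column empty two   = refl
    column one   empty = refl
    column one   one   = refl
    column one   two   = refl
    column two   empty = refl
    column two   one   = refl
    column two   two   = refl
  painted-swap : ∀ {m} (h : Grid m) → painted (swapGrid h) ≡ painted h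
  painted-swap [] = refl
  painted-swap ((a , b) ∷ h) = cong₂ _+_ (cong₂ _+_ (slot a) (slot b)) (painted-swap h)
    where
    slot : ∀ a → isPainted (swapSlot a) ≡ isPainted a
    slot empty = refl
    slot one   = refl
    slot two   = refl

countTwo : ∀ m p → count m (OnlyTwo p) ≡ (2 * m) C p
countTwo m p = begin
  count m (OnlyTwo p)                       ≡⟨ sym (sumGrids-swap m (λ h → 𝟙 (OnlyTwo p h))) ⟩
  count m (λ h → OnlyTwo p (swapGrid h))    ≡⟨ sumGrids-cong m (λ h → cong 𝟙 (OnlyTwo-swap p h)) ⟩
  count m (OnlyOne p)                       ≡⟨ countOne m p ⟩
  (2 * m) C p                               ∎

countOfType : ∀ i j → count (i + j) (λ g → isOrdered g ∧ (colorOneCount g ≡ᵇ i)) ≡ central i * central j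
countOfType i j = begin
  count (i + j) (λ g → isOrdered g ∧ (colorOneCount g ≡ᵇ i))
    ≡⟨ sumGrids-++ i j _ ⟩
  sumGrids i (λ h → sumGrids j (λ k → 𝟙 (isOrdered (h ++ k) ∧ (colorOneCount (h ++ k) ≡ᵇ i))))
    ≡⟨ sumGrids-cong i (λ h → sumGrids-cong j (λ k →
         trans (cong 𝟙 (ordered-of-type h k)) (𝟙-∧ (OnlyOne i h) (OnlyTwo j k)))) ⟩
  sumGrids i (λ h → sumGrids j (λ k → 𝟙 (OnlyOne i h) * 𝟙 (OnlyTwo j k)))
    ≡⟨ sumGrids-product i j _ _ ⟩
  count i (OnlyOne i) * count j (OnlyTwo j)
    ≡⟨ cong₂ _*_ (countOne i i) (countTwo j j) ⟩
  central i * central j ∎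

classify : ∀ K x b → (T b → x < K) → 𝟙 b ≡ sumTo K (λ i → 𝟙 (b ∧ (x ≡ᵇ i)))
classify K x false _   = sym (sumTo-zero K)
classify K x true  x<K = sym (exactly-one K x (x<K tt))
  where
  exactly-one : ∀ K x → x < K → sumTo K (λ i → 𝟙 (x ≡ᵇ i)) ≡ 1
  exactly-one (suc K) zero    _         = cong suc (sumTo-zero K)
  exactly-one (suc K) (suc x) (s≤s x<K) = exactly-one K x x<K

type-bound : ∀ {n} (g : Grid n) → T (isOrdered g) → colorOneCount g < suc n
type-bound {n} g ordered = s≤s (subst (colorOneCount g ≤_) painted-g (colorOne≤painted g))
  where
  painted-g : painted g ≡ n
  painted-g = ≡ᵇ⇒≡ _ _ (proj₁ (∧-split {painted g ≡ᵇ n} (proj₁ (∧-split {isConfig g} ordered))))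
  colorOne≤painted : ∀ {m} (g : Grid m) → colorOneCount g ≤ painted g
  colorOne≤painted []              = z≤n
  colorOne≤painted ((a , b) ∷ g) = +-mono-≤ (+-mono-≤ (slot a) (slot b)) (colorOne≤painted g)
    where
    slot : ∀ s → isOne s ≤ isPainted s
    slot empty = z≤n
    slot one   = s≤s z≤n
    slot two   = z≤n

countOrdered : ∀ n → count n isOrdered ≡ 4 ^ n
countOrdered n = begin
  count n isOrdered
    ≡⟨ sumGrids-cong n (λ g → classify (suc n) (colorOneCount g) (isOrdered g) (type-bound g)) ⟩
  sumGrids n (λ g → sumTo (suc n) (λ i → 𝟙 (isOrdered g ∧ (colorOneCount g ≡ᵇ i))))
    ≡⟨ sumGrids-sumTo n (suc n) (λ i g → 𝟙 (isOrdered g ∧ (colorOneCount g ≡ᵇ i))) ⟩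
  sumTo (suc n) (λ i → count n (λ g → isOrdered g ∧ (colorOneCount g ≡ᵇ i)))
    ≡⟨ sumTo-cong (suc n) (λ i i<1+n → ofType i (≤-pred i<1+n)) ⟩
  sumTo (suc n) (λ i → central i * central (n ∸ i))
    ≡⟨ sym (conv-sumTo n central central) ⟩
  conv central central n
    ≡⟨ S≡4^ n ⟩
  4 ^ n ∎
  where
  ofType : ∀ i → i ≤ n → count n (λ g → isOrdered g ∧ (colorOneCount g ≡ᵇ i)) ≡ central i * central (n ∸ i)
  ofType i i≤n = subst (λ m → count m (λ g → isOrdered g ∧ (colorOneCount g ≡ᵇ i)) ≡ central i * central (n ∸ i))
                       (m+[n∸m]≡n i≤n) (countOfType i (n ∸ i))

TowerFreeWith : ∀ {m} → ℕ → Grid m → Bool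
TowerFreeWith p g = ((painted g ≡ᵇ p) ∧ allCols monochrome g) ∧ allCols noTower g

-- Each column of a tower-free grid has at most one painted slot, so a width-m
-- grid has at most m painted slots; with exactly m, each column is one of the
-- four columns with a single painted slot.
towerFreeCount : ℕ → ℕ → ℕ
towerFreeCount m zero    = 4 ^ m
towerFreeCount m (suc e) = 0

countTowerFree : ∀ m e → count m (TowerFreeWith (m + e)) ≡ towerFreeCount m e
countTowerFree zero    zero    = refl
countTowerFree zero    (suc e) = refl
countTowerFree (suc m) e =
  trans (sumSlots-cong λ a → sumSlots-cong λ b → column a b) (four-columns e)
  where
  value : ℕ → Slot → Slot → ℕ
  value e empty empty = towerFreeCount m (suc e)
  value e empty _     = towerFreeCount m e
  value e _     empty = towerFreeCount m e
  value e _     _     = 0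
  column : ∀ a b → count m (λ g → TowerFreeWith (suc (m + e)) (col a b g)) ≡ value e a b
  column empty empty = trans (cong (λ p → count m (TowerFreeWith p)) (sym (+-suc m e)))
                             (countTowerFree m (suc e))
  column empty one   = countTowerFree m e
  column empty two   = countTowerFree m e
  column one   empty = countTowerFree m e
  column two   empty = countTowerFree m e
  column one   one   = count-∧false m _
  column one   two   = count-∧false m _
  column two   one   = count-∧false m _
  column two   two   = count-∧false m _
  four-columns : ∀ e → sumSlots (λ a → sumSlots (value e a)) ≡ towerFreeCount (suc m) e
  four-columns zero    = four (4 ^ m)
    where
    four : ∀ t → (0 + (t + t)) + ((t + (0 + 0)) + (t + (0 + 0))) ≡ 4 * t
    four = solve-∀
  four-columns (suc e) = refl

countTowerFreeConfigurations : ∀ n → count n (λ g → isConfig g ∧ allCols noTower g) ≡ 4 ^ n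
countTowerFreeConfigurations n = subst (λ p → count n (TowerFreeWith p) ≡ 4 ^ n) (+-identityʳ n) (countTowerFree n 0)

-- The theorem: 𝒪ₙ ↔ Fin 4ⁿ ↔ 𝒯ₙ.  (The counting argument does not need n ≥ 1.)
theorem2p2 : (n : ℕ) → n ≥ 1 → Ordered n ⤖ TowerFree n
theorem2p2 n _ = ↔⇒⤖ (↔-trans (enumerate n isOrdered)
                      (↔-trans same-size
                               (↔-sym (enumerate n (λ g → isConfig g ∧ allCols noTower g)))))
  where
  same-size : Fin (count n isOrdered) ↔ Fin (count n (λ g → isConfig g ∧ allCols noTower g))
  same-size = subst (λ k → Fin (count n isOrdered) ↔ Fin k)
                    (trans (countOrdered n) (sym (countTowerFreeConfigurations n))) ↔-refl
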